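{- Let $a\ge0$ be an integer and let $Y$, $S$ be tableaux with product $A=Y\cdot S$. Let $A=\tilde A\cdot A_0$ and $Y=\tilde Y\cdot Y_0$ be the horizontal cuts of $A$ and $Y$ after row $a$, and let $\tilde Y=M\cdot N$ be any factorization. Then $N\cdot Y_0\cdot S=\tilde A'\cdot A_0$ for some tableau $\tilde A'$, and $M\cdot\tilde A'=\tilde A$.
   Context: Tableaux are semistandard Young tableaux with integer entries (empty allowed); $T\cdot U$ is the tableau product (row-insert into $T$ the row reading word of $U$, rows read left to right from bottom to top). The horizontal cut of a tableau $B$ after row $a$ is the factorization $B=\tilde B\cdot B_0$ where $B_0$ is the tableau formed by the top $a$ rows of $B$ and $\tilde B$ the tableau formed by the remaining rows. -}

module Defs where

open import Data.Nat using (ℕ)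
open import Data.Integer using (ℤ; _<_; _≤_; _<?_)
open import Data.List using (List; []; _∷_; concat; reverse; foldl; take; drop)
open import Data.List.Relation.Unary.Linked using (Linked)
open import Data.Maybe using (Maybe; just; nothing)
open import Data.Product using (_×_; _,_)
open import Data.Unit using (⊤)
open import Data.Empty using (⊥)
open import Relation.Nullary using (yes; no; ¬_)
open import Relation.Binary.PropositionalEquality using (_≡_)

-- A tableau is represented by its list of rows, top row first (English
-- convention).  Valid tableaux have no empty rows, so the empty tableau is [].
Row : Set
Row = List ℤ

Tab : Set
Tab = List Row

-- column strictness between an upper row and the row directly below it
-- (also forces the lower row to be no longer than the upper one)
ColStrict : Row → Row → Set
ColStrict _ [] = ⊤
ColStrict [] (_ ∷ _) = ⊥
ColStrict (u ∷ us) (l ∷ ls) = (u < l) × ColStrict us ls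

IsTableau : Tab → Set
IsTableau [] = ⊤
IsTableau (r ∷ []) = ¬ (r ≡ []) × Linked _≤_ r
IsTableau (r ∷ s ∷ rs) = ¬ (r ≡ []) × Linked _≤_ r × ColStrict r s × IsTableau (s ∷ rs)

insertRow : ℤ → Row → Maybe ℤ × Row
insertRow x [] = nothing , x ∷ []
insertRow x (y ∷ ys) with x <? y
... | yes _ = just y , x ∷ ys
... | no _ with insertRow x ys
...   | b , r = b , y ∷ r

insert : ℤ → Tab → Tab
insert x [] = (x ∷ []) ∷ []
insert x (r ∷ rs) with insertRow x r
... | nothing , r' = r' ∷ rs
... | just y , r' = r' ∷ insert y rs

readingWord : Tab → List ℤ
readingWord T = concat (reverse T)

infixl 7 _·_
_·_ : Tab → Tab → Tab
T · U = foldl (λ t x → insert x t) T (readingWord U)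

-- horizontal cut of B after row a:  B = cutLower a B · cutTop a B
cutTop : ℕ → Tab → Tab
cutTop = take

cutLower : ℕ → Tab → Tab
cutLower = drop

{-# OPTIONS --safe #-}
-- Inserting a word w into a tableau T row by row, the top a rows of T ◁ w
-- depend only on the top a rows T₀ of T, and the rows below are obtained by
-- inserting into the lower part T̃ the word o bumped out of row a.  Applied
-- to Y and the reading word s of S, this gives Ã = Ỹ ◁ o = M ◁ (word N ++ o)
-- = M · (N ◁ o), so Ã′ = N ◁ o.  The remaining identity
-- N ◁ (word Y₀ ++ s) = N ◁ (o ++ word A₀) holds because both words are
-- plactically equivalent to the reading word of Y₀ ◁ s: the reading word of
-- T ◁ w is equivalent to word T ++ w, and Knuth moves do not change the
-- result of inserting a word into a tableau.
module Submission where

open import Defs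
open import Data.Nat using (ℕ; zero; suc)
open import Data.Integer using (ℤ; _<_; _≤_; _<?_)
import Data.Integer.Properties as ℤ
open import Data.List using (List; []; _∷_; _++_; concat; reverse; foldl; take; drop; fromMaybe)
import Data.List.Properties as List
open import Data.List.Relation.Unary.Linked using (Linked; [-]; _∷_)
import Data.List.Relation.Unary.Linked as Linked
open import Data.List.Relation.Unary.Linked.Properties using (Linked⇒All)
open import Data.List.Relation.Unary.All using (All; []; _∷_)
import Data.List.Relation.Unary.All as All
import Data.List.Relation.Unary.All.Properties as All
open import Data.Maybe using (Maybe; just; nothing)
open import Data.Maybe.Relation.Unary.All as Maybe using (just; nothing)
open import Data.Maybe.Relation.Unary.Any as Maybe using (just)
open import Data.Product using (Σ; _×_; _,_; proj₁; proj₂)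
open import Data.Sum using (_⊎_; inj₁; inj₂)
open import Data.Empty using (⊥)
open import Data.Unit using (⊤; tt)
open import Relation.Nullary using (yes; no; ¬_; contradiction)
open import Relation.Binary.PropositionalEquality
open import Relation.Binary.Bundles using (Setoid)
import Relation.Binary.Reasoning.Setoid as SetoidReasoning
open import Level using (0ℓ)

Sorted : Row → Set
Sorted = Linked _≤_

<⊎≥ : (x y : ℤ) → x < y ⊎ y ≤ x
<⊎≥ x y with x <? y
... | yes x<y = inj₁ x<y
... | no x≮y = inj₂ (ℤ.≮⇒≥ x≮y)

head≤tail : ∀ {h t} → Sorted (h ∷ t) → All (h ≤_) t
head≤tail [-] = []
head≤tail (h≤x ∷ s) = Linked⇒All ℤ.≤-trans h≤x s

sorted-∷ : ∀ {h t} → All (h ≤_) t → Sorted t → Sorted (h ∷ t)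
sorted-∷ [] _ = [-]
sorted-∷ (h≤x ∷ _) s = h≤x ∷ s

insertRow-bumps : ∀ {x h} t → x < h → insertRow x (h ∷ t) ≡ (just h , x ∷ t)
insertRow-bumps {x} {h} t x<h with x <? h
... | yes _ = refl
... | no x≮h = contradiction x<h x≮h

insertRow-passes : ∀ {x h} t → h ≤ x →
  insertRow x (h ∷ t) ≡ (proj₁ (insertRow x t) , h ∷ proj₂ (insertRow x t))
insertRow-passes {x} {h} t h≤x with x <? h
... | yes x<h = contradiction h≤x (ℤ.<⇒≱ x<h)
... | no _ with insertRow x t
...   | _ , _ = refl

insertRow-All : ∀ {P : ℤ → Set} {x} t → All P t → P x → All P (proj₂ (insertRow x t))
insertRow-All [] _ px = px ∷ []
insertRow-All {x = x} (h ∷ t) (ph ∷ pt) px with <⊎≥ x h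
... | inj₁ x<h rewrite insertRow-bumps t x<h = px ∷ pt
... | inj₂ h≤x rewrite insertRow-passes t h≤x = ph ∷ insertRow-All t pt px

bumped-All : ∀ {P : ℤ → Set} {x} t → All P t → Maybe.All P (proj₁ (insertRow x t))
bumped-All [] _ = nothing
bumped-All {x = x} (h ∷ t) (ph ∷ pt) with <⊎≥ x h
... | inj₁ x<h rewrite insertRow-bumps t x<h = just ph
... | inj₂ h≤x rewrite insertRow-passes t h≤x = bumped-All t pt

bumped-> : ∀ {x} t → Maybe.All (x <_) (proj₁ (insertRow x t))
bumped-> [] = nothing
bumped-> {x} (h ∷ t) with <⊎≥ x h
... | inj₁ x<h rewrite insertRow-bumps t x<h = just x<h
... | inj₂ h≤x rewrite insertRow-passes t h≤x = bumped-> t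

insertRow-sorted : ∀ {x} r → Sorted r → Sorted (proj₂ (insertRow x r))
insertRow-sorted [] _ = [-]
insertRow-sorted {x} (h ∷ t) s with <⊎≥ x h
... | inj₁ x<h rewrite insertRow-bumps t x<h =
  sorted-∷ (All.map (ℤ.≤-trans (ℤ.<⇒≤ x<h)) (head≤tail s)) (Linked.tail s)
... | inj₂ h≤x rewrite insertRow-passes t h≤x =
  sorted-∷ (insertRow-All t (head≤tail s) h≤x) (insertRow-sorted t (Linked.tail s))

-- Row bumping lemma (Fulton, Young Tableaux, §1.1), for the bumped entries.
Bumped≤ : Maybe ℤ → Maybe ℤ → Set
Bumped≤ nothing c = c ≡ nothing
Bumped≤ (just b) c = Maybe.All (b ≤_) c

rowBumping-≤ : ∀ {y z} t → Sorted t → y ≤ z →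
  Bumped≤ (proj₁ (insertRow y t)) (proj₁ (insertRow z (proj₂ (insertRow y t))))
rowBumping-≤ {y} {z} [] _ y≤z rewrite insertRow-passes {z} {y} [] y≤z = refl
rowBumping-≤ {y} {z} (g ∷ t) s y≤z with <⊎≥ y g
... | inj₁ y<g rewrite insertRow-bumps t y<g | insertRow-passes t y≤z = bumped-All t (head≤tail s)
... | inj₂ g≤y rewrite insertRow-passes t g≤y | insertRow-passes (proj₂ (insertRow y t)) (ℤ.≤-trans g≤y y≤z) =
  rowBumping-≤ t (Linked.tail s) y≤z

rowBumping-> : ∀ {y z} t → y < z → Maybe.Any (_≤ z) (proj₁ (insertRow y (proj₂ (insertRow z t))))
rowBumping-> {y} {z} [] y<z rewrite insertRow-bumps {y} {z} [] y<z = just ℤ.≤-refl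
rowBumping-> {y} {z} (g ∷ t) y<z with <⊎≥ z g
... | inj₁ z<g rewrite insertRow-bumps t z<g | insertRow-bumps t y<z = just ℤ.≤-refl
... | inj₂ g≤z rewrite insertRow-passes t g≤z with <⊎≥ y g
...   | inj₁ y<g rewrite insertRow-bumps (proj₂ (insertRow z t)) y<g = just g≤z
...   | inj₂ g≤y rewrite insertRow-passes (proj₂ (insertRow z t)) g≤y = rowBumping-> t y<z

insertRowWord : Row → List ℤ → Row × List ℤ
insertRowWord r [] = r , []
insertRowWord r (x ∷ w) =
  proj₁ (insertRowWord (proj₂ (insertRow x r)) w) ,
  fromMaybe (proj₁ (insertRow x r)) ++ proj₂ (insertRowWord (proj₂ (insertRow x r)) w)

insertRowWord-∷ : ∀ {h} t w → All (h ≤_) w →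
  insertRowWord (h ∷ t) w ≡ (h ∷ proj₁ (insertRowWord t w) , proj₂ (insertRowWord t w))
insertRowWord-∷ t [] _ = refl
insertRowWord-∷ t (x ∷ w) (h≤x ∷ h≤w)
  rewrite insertRow-passes t h≤x | insertRowWord-∷ (proj₂ (insertRow x t)) w h≤w = refl

data KnuthMove : List ℤ → List ℤ → Set where
  yzx↦yxz : ∀ {x y z} → x < y → y ≤ z → KnuthMove (y ∷ z ∷ x ∷ []) (y ∷ x ∷ z ∷ [])
  xzy↦zxy : ∀ {x y z} → x ≤ y → y < z → KnuthMove (x ∷ z ∷ y ∷ []) (z ∷ x ∷ y ∷ [])

RowKnuth : Row → List ℤ → List ℤ → Set
RowKnuth r u v =
  insertRowWord r u ≡ insertRowWord r v ⊎
  proj₁ (insertRowWord r u) ≡ proj₁ (insertRowWord r v) ×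
  KnuthMove (proj₂ (insertRowWord r u)) (proj₂ (insertRowWord r v))

RowKnuth-∷ : ∀ {h u v} t → All (h ≤_) u → All (h ≤_) v → RowKnuth t u v → RowKnuth (h ∷ t) u v
RowKnuth-∷ {h} {u} {v} t h≤u h≤v rk rewrite insertRowWord-∷ t u h≤u | insertRowWord-∷ t v h≤v with rk
... | inj₁ eq = inj₁ (cong (λ p → h ∷ proj₁ p , proj₂ p) eq)
... | inj₂ (eq , k) = inj₂ (cong (h ∷_) eq , k)

rowKnuth-[] : ∀ {u v} → KnuthMove u v → insertRowWord [] u ≡ insertRowWord [] v
rowKnuth-[] (yzx↦yxz {x} {y} {z} x<y y≤z)
  rewrite insertRow-passes {z} {y} [] y≤z | insertRow-bumps {x} {y} (z ∷ []) x<y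
        | insertRow-bumps {x} {y} [] x<y | insertRow-passes {z} {x} [] (ℤ.≤-trans (ℤ.<⇒≤ x<y) y≤z) = refl
rowKnuth-[] (xzy↦zxy {x} {y} {z} x≤y y<z)
  rewrite insertRow-passes {z} {x} [] (ℤ.≤-trans x≤y (ℤ.<⇒≤ y<z)) | insertRow-passes {y} {x} (z ∷ []) x≤y
        | insertRow-bumps {y} {z} [] y<z | insertRow-bumps {x} {z} [] (ℤ.≤-<-trans x≤y y<z)
        | insertRow-passes {y} {x} [] x≤y = refl

rowKnuth : ∀ {u v} r → Sorted r → KnuthMove u v → RowKnuth r u v
rowKnuth-yzx : ∀ {h x y z} t → Sorted (h ∷ t) → x < y → y ≤ z →
  RowKnuth (h ∷ t) (y ∷ z ∷ x ∷ []) (y ∷ x ∷ z ∷ [])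
rowKnuth-xzy : ∀ {h x y z} t → Sorted (h ∷ t) → x ≤ y → y < z →
  RowKnuth (h ∷ t) (x ∷ z ∷ y ∷ []) (z ∷ x ∷ y ∷ [])

rowKnuth [] _ k = inj₁ (rowKnuth-[] k)
rowKnuth (h ∷ t) s (yzx↦yxz x<y y≤z) = rowKnuth-yzx t s x<y y≤z
rowKnuth (h ∷ t) s (xzy↦zxy x≤y y<z) = rowKnuth-xzy t s x≤y y<z

rowKnuth-yzx {h} {x} {y} {z} t s x<y y≤z with <⊎≥ y h
... | inj₁ y<h
  rewrite insertRow-bumps t y<h | insertRow-passes t y≤z
        | insertRow-bumps (proj₂ (insertRow z t)) x<y | insertRow-bumps t x<y
        | insertRow-passes t (ℤ.≤-trans (ℤ.<⇒≤ x<y) y≤z)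
  with proj₁ (insertRow z t) | bumped-All {P = h ≤_} {x = z} t (head≤tail s)
...   | nothing | _ = inj₁ refl
...   | just b | just h≤b = inj₂ (refl , yzx↦yxz y<h h≤b)
rowKnuth-yzx {h} {x} {y} {z} t s x<y y≤z | inj₂ h≤y with <⊎≥ x h
... | inj₁ x<h
  rewrite insertRow-passes t h≤y | insertRow-passes (proj₂ (insertRow y t)) (ℤ.≤-trans h≤y y≤z)
        | insertRow-bumps (proj₂ (insertRow z (proj₂ (insertRow y t)))) x<h
        | insertRow-bumps (proj₂ (insertRow y t)) x<h
        | insertRow-passes (proj₂ (insertRow y t)) (ℤ.≤-trans (ℤ.<⇒≤ x<y) y≤z)
  with proj₁ (insertRow y t) | proj₁ (insertRow z (proj₂ (insertRow y t)))
     | rowBumping-≤ {y} {z} t (Linked.tail s) y≤z | bumped-> {y} t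
...   | nothing | nothing | _ | _ = inj₁ refl
...   | nothing | just _ | () | _
...   | just _ | nothing | _ | _ = inj₁ refl
...   | just b | just _ | just b≤c | just y<b = inj₂ (refl , yzx↦yxz (ℤ.≤-<-trans h≤y y<b) b≤c)
rowKnuth-yzx {h} {x} {y} {z} t s x<y y≤z | inj₂ h≤y | inj₂ h≤x =
  RowKnuth-∷ t (h≤y ∷ h≤z ∷ h≤x ∷ []) (h≤y ∷ h≤x ∷ h≤z ∷ []) (rowKnuth t (Linked.tail s) (yzx↦yxz x<y y≤z))
  where h≤z = ℤ.≤-trans h≤y y≤z

rowKnuth-xzy {h} {x} {y} {z} t s x≤y y<z with <⊎≥ x h
... | inj₂ h≤x =
  RowKnuth-∷ t (h≤x ∷ h≤z ∷ h≤y ∷ []) (h≤z ∷ h≤x ∷ h≤y ∷ []) (rowKnuth t (Linked.tail s) (xzy↦zxy x≤y y<z))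
  where h≤y = ℤ.≤-trans h≤x x≤y
        h≤z = ℤ.≤-trans h≤y (ℤ.<⇒≤ y<z)
... | inj₁ x<h with <⊎≥ z h
...   | inj₂ h≤z
  rewrite insertRow-bumps t x<h | insertRow-passes t (ℤ.≤-trans x≤y (ℤ.<⇒≤ y<z))
        | insertRow-passes (proj₂ (insertRow z t)) x≤y | insertRow-passes t h≤z
        | insertRow-bumps (proj₂ (insertRow z t)) x<h | insertRow-passes (proj₂ (insertRow z t)) x≤y
  with proj₁ (insertRow z t) | bumped-> {z} t
     | proj₁ (insertRow y (proj₂ (insertRow z t))) | rowBumping-> {y} {z} t y<z
     | bumped-All {P = h ≤_} {x = y} (proj₂ (insertRow z t)) (insertRow-All t (head≤tail s) h≤z)
...     | nothing | _ | _ | _ | _ = inj₁ refl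
...     | just _ | _ | nothing | () | _
...     | just _ | just z<c | just _ | just d≤z | just h≤d =
  inj₂ (refl , xzy↦zxy h≤d (ℤ.≤-<-trans d≤z z<c))
rowKnuth-xzy {h} {x} {y} {z} [] s x≤y y<z | inj₁ x<h | inj₁ z<h
  rewrite insertRow-bumps [] x<h | insertRow-passes [] (ℤ.≤-trans x≤y (ℤ.<⇒≤ y<z))
        | insertRow-passes (z ∷ []) x≤y | insertRow-bumps [] y<z | insertRow-bumps [] z<h
        | insertRow-bumps [] (ℤ.≤-<-trans x≤y y<z) | insertRow-passes [] x≤y = inj₁ refl
rowKnuth-xzy {h} {x} {y} {z} (g ∷ t) s x≤y y<z | inj₁ x<h | inj₁ z<h
  rewrite insertRow-bumps (g ∷ t) x<h | insertRow-passes (g ∷ t) (ℤ.≤-trans x≤y (ℤ.<⇒≤ y<z))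
        | insertRow-bumps t (ℤ.<-≤-trans z<h (Linked.head s))
        | insertRow-passes (z ∷ t) x≤y | insertRow-bumps t y<z
        | insertRow-bumps (g ∷ t) z<h | insertRow-bumps (g ∷ t) (ℤ.≤-<-trans x≤y y<z)
        | insertRow-passes (g ∷ t) x≤y
        | insertRow-bumps t (ℤ.<-trans y<z (ℤ.<-≤-trans z<h (Linked.head s))) =
  inj₂ (refl , yzx↦yxz z<h (Linked.head s))

infixl 6 _◁_
_◁_ : Tab → List ℤ → Tab
T ◁ w = foldl (λ t x → insert x t) T w

RowsSorted : Tab → Set
RowsSorted = All Sorted

insertMaybe : Maybe ℤ → Tab → Tab
insertMaybe nothing T = T
insertMaybe (just y) T = insert y T

insert-∷ : ∀ x r T → insert x (r ∷ T) ≡ proj₂ (insertRow x r) ∷ insertMaybe (proj₁ (insertRow x r)) T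
insert-∷ x r T with insertRow x r
... | nothing , _ = refl
... | just _ , _ = refl

insertMaybe-◁ : ∀ b T w → insertMaybe b T ◁ w ≡ T ◁ (fromMaybe b ++ w)
insertMaybe-◁ nothing T w = refl
insertMaybe-◁ (just y) T w = refl

◁-++ : ∀ T u w → T ◁ (u ++ w) ≡ T ◁ u ◁ w
◁-++ T u w = List.foldl-++ (λ t x → insert x t) T u w

◁-∷ : ∀ r T w → (r ∷ T) ◁ w ≡ proj₁ (insertRowWord r w) ∷ T ◁ proj₂ (insertRowWord r w)
◁-∷ r T [] = refl
◁-∷ r T (x ∷ w) rewrite insert-∷ x r T =
  trans (◁-∷ (proj₂ (insertRow x r)) (insertMaybe (proj₁ (insertRow x r)) T) w)
        (cong (proj₁ (insertRowWord (proj₂ (insertRow x r)) w) ∷_) (insertMaybe-◁ (proj₁ (insertRow x r)) T _))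

◁-∷-cong : ∀ {r u v} T → insertRowWord r u ≡ insertRowWord r v → (r ∷ T) ◁ u ≡ (r ∷ T) ◁ v
◁-∷-cong {r} {u} {v} T eq = begin
  (r ∷ T) ◁ u                                              ≡⟨ ◁-∷ r T u ⟩
  proj₁ (insertRowWord r u) ∷ T ◁ proj₂ (insertRowWord r u) ≡⟨ cong (λ p → proj₁ p ∷ T ◁ proj₂ p) eq ⟩
  proj₁ (insertRowWord r v) ∷ T ◁ proj₂ (insertRowWord r v) ≡⟨ ◁-∷ r T v ⟨
  (r ∷ T) ◁ v                                              ∎
  where open ≡-Reasoning

insert-rowsSorted : ∀ {x} T → RowsSorted T → RowsSorted (insert x T)
insert-rowsSorted [] _ = [-] ∷ []
insert-rowsSorted {x} (r ∷ T) (s ∷ ss) rewrite insert-∷ x r T with proj₁ (insertRow x r)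
... | nothing = insertRow-sorted r s ∷ ss
... | just _ = insertRow-sorted r s ∷ insert-rowsSorted T ss

◁-rowsSorted : ∀ T w → RowsSorted T → RowsSorted (T ◁ w)
◁-rowsSorted T [] s = s
◁-rowsSorted T (x ∷ w) s = ◁-rowsSorted (insert x T) w (insert-rowsSorted T s)

-- [] ◁ u reduces to ([] ∷ []) ◁ u once u is seen to be nonempty.
◁-knuth : ∀ {u v} T → RowsSorted T → KnuthMove u v → T ◁ u ≡ T ◁ v
◁-knuth {u} {v} [] _ k@(yzx↦yxz _ _) = ◁-∷-cong {[]} {u} {v} [] (rowKnuth-[] k)
◁-knuth {u} {v} [] _ k@(xzy↦zxy _ _) = ◁-∷-cong {[]} {u} {v} [] (rowKnuth-[] k)
◁-knuth {u} {v} (r ∷ T) (s ∷ ss) k with rowKnuth r s k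
... | inj₁ eq = ◁-∷-cong T eq
... | inj₂ (eq , k′) rewrite ◁-∷ r T u | ◁-∷ r T v = cong₂ _∷_ eq (◁-knuth T ss k′)

-- Plactic equivalence, taken semantically: it contains the Knuth moves and
-- is a congruence, which is all that is used.
infix 4 _≈_
record _≈_ (u v : List ℤ) : Set where
  constructor mk≈
  field same-insertion : ∀ T → RowsSorted T → T ◁ u ≡ T ◁ v
open _≈_

≈-refl : ∀ {u} → u ≈ u
≈-refl = mk≈ λ _ _ → refl

≈-reflexive : ∀ {u v} → u ≡ v → u ≈ v
≈-reflexive refl = ≈-refl

≈-sym : ∀ {u v} → u ≈ v → v ≈ u
≈-sym u≈v = mk≈ λ T s → sym (same-insertion u≈v T s)

≈-trans : ∀ {u v w} → u ≈ v → v ≈ w → u ≈ w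
≈-trans u≈v v≈w = mk≈ λ T s → trans (same-insertion u≈v T s) (same-insertion v≈w T s)

≈-setoid : Setoid 0ℓ 0ℓ
≈-setoid = record
  { Carrier = List ℤ
  ; _≈_ = _≈_
  ; isEquivalence = record { refl = ≈-refl ; sym = ≈-sym ; trans = ≈-trans }
  }

module ≈-Reasoning = SetoidReasoning ≈-setoid

≈-congʳ : ∀ {u v} w → u ≈ v → u ++ w ≈ v ++ w
≈-congʳ {u} {v} w u≈v = mk≈ λ T s → begin
  T ◁ (u ++ w) ≡⟨ ◁-++ T u w ⟩
  T ◁ u ◁ w    ≡⟨ cong (_◁ w) (same-insertion u≈v T s) ⟩
  T ◁ v ◁ w    ≡⟨ ◁-++ T v w ⟨
  T ◁ (v ++ w) ∎
  where open ≡-Reasoning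

≈-congˡ : ∀ {u v} w → u ≈ v → w ++ u ≈ w ++ v
≈-congˡ {u} {v} w u≈v = mk≈ λ T s → begin
  T ◁ (w ++ u) ≡⟨ ◁-++ T w u ⟩
  T ◁ w ◁ u    ≡⟨ same-insertion u≈v (T ◁ w) (◁-rowsSorted T w s) ⟩
  T ◁ w ◁ v    ≡⟨ ◁-++ T w v ⟨
  T ◁ (w ++ v) ∎
  where open ≡-Reasoning

≈-knuth : ∀ {u v} p q → KnuthMove u v → p ++ u ++ q ≈ p ++ v ++ q
≈-knuth p q k = ≈-congˡ p (≈-congʳ q (mk≈ λ T s → ◁-knuth T s k))

≈-moveLeft : ∀ p q x → Sorted (p ∷ q) → x < p → p ∷ q ++ x ∷ [] ≈ p ∷ x ∷ q
≈-moveLeft p [] x _ _ = ≈-refl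
≈-moveLeft p (v ∷ q) x s x<p =
  ≈-trans (≈-congˡ (p ∷ []) (≈-moveLeft v q x (Linked.tail s) (ℤ.<-≤-trans x<p (Linked.head s))))
          (≈-knuth [] q (yzx↦yxz x<p (Linked.head s)))

HeadBetween : ℤ → ℤ → Row → Set
HeadBetween h x [] = ⊥
HeadBetween h x (c ∷ _) = h ≤ c × c ≤ x

insertRow-headBetween : ∀ {h x} t → h ≤ x → All (h ≤_) t → HeadBetween h x (proj₂ (insertRow x t))
insertRow-headBetween [] h≤x _ = h≤x , ℤ.≤-refl
insertRow-headBetween {h} {x} (g ∷ t) h≤x (h≤g ∷ _) with <⊎≥ x g
... | inj₁ x<g rewrite insertRow-bumps t x<g = h≤x , ℤ.≤-refl
... | inj₂ g≤x rewrite insertRow-passes t g≤x = h≤g , g≤x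

≈-swapHead : ∀ {h x y} l → HeadBetween h x l → x < y → h ∷ y ∷ l ≈ y ∷ h ∷ l
≈-swapHead (c ∷ l) (h≤c , c≤x) x<y = ≈-knuth [] l (xzy↦zxy h≤c (ℤ.≤-<-trans c≤x x<y))

≈-insertRow : ∀ {x} r → Sorted r →
  r ++ x ∷ [] ≈ fromMaybe (proj₁ (insertRow x r)) ++ proj₂ (insertRow x r)
≈-insertRow [] _ = ≈-refl
≈-insertRow {x} (h ∷ t) s with <⊎≥ x h
... | inj₁ x<h rewrite insertRow-bumps t x<h = ≈-moveLeft h t x s x<h
... | inj₂ h≤x rewrite insertRow-passes t h≤x
  with proj₁ (insertRow x t) | ≈-insertRow {x} t (Linked.tail s) | bumped-> {x} t
...   | nothing | t≈ | _ = ≈-congˡ (h ∷ []) t≈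
...   | just y | t≈ | just x<y =
  ≈-trans (≈-congˡ (h ∷ []) t≈)
          (≈-swapHead (proj₂ (insertRow x t)) (insertRow-headBetween t h≤x (head≤tail s)) x<y)

readingWord-++ : ∀ T U → readingWord (T ++ U) ≡ readingWord U ++ readingWord T
readingWord-++ T U =
  trans (cong concat (List.reverse-++ T U)) (sym (List.concat-++ (reverse U) (reverse T)))

readingWord-∷ : ∀ r T → readingWord (r ∷ T) ≡ readingWord T ++ r
readingWord-∷ r T = trans (readingWord-++ (r ∷ []) T) (cong (readingWord T ++_) (List.++-identityʳ r))

readingWord-insert : ∀ {x} T → RowsSorted T → readingWord (insert x T) ≈ readingWord T ++ x ∷ []
readingWord-insertMaybe : ∀ b T → RowsSorted T → readingWord (insertMaybe b T) ≈ readingWord T ++ fromMaybe b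

readingWord-insert [] _ = ≈-refl
readingWord-insert {x} (r ∷ T) (s ∷ ss) = begin
  readingWord (insert x (r ∷ T))           ≡⟨ cong readingWord (insert-∷ x r T) ⟩
  readingWord (r′ ∷ insertMaybe b T)       ≡⟨ readingWord-∷ r′ (insertMaybe b T) ⟩
  readingWord (insertMaybe b T) ++ r′      ≈⟨ ≈-congʳ r′ (readingWord-insertMaybe b T ss) ⟩
  (readingWord T ++ fromMaybe b) ++ r′     ≡⟨ List.++-assoc (readingWord T) (fromMaybe b) r′ ⟩
  readingWord T ++ fromMaybe b ++ r′       ≈⟨ ≈-congˡ (readingWord T) (≈-insertRow r s) ⟨
  readingWord T ++ r ++ x ∷ []             ≡⟨ List.++-assoc (readingWord T) r (x ∷ []) ⟨
  (readingWord T ++ r) ++ x ∷ []           ≡⟨ cong (_++ x ∷ []) (readingWord-∷ r T) ⟨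
  readingWord (r ∷ T) ++ x ∷ []            ∎
  where
  open ≈-Reasoning
  b = proj₁ (insertRow x r)
  r′ = proj₂ (insertRow x r)

readingWord-insertMaybe nothing T _ = ≈-reflexive (sym (List.++-identityʳ (readingWord T)))
readingWord-insertMaybe (just y) T s = readingWord-insert T s

readingWord-◁ : ∀ T w → RowsSorted T → readingWord (T ◁ w) ≈ readingWord T ++ w
readingWord-◁ T [] _ = ≈-reflexive (sym (List.++-identityʳ (readingWord T)))
readingWord-◁ T (x ∷ w) s = begin
  readingWord (insert x T ◁ w)     ≈⟨ readingWord-◁ (insert x T) w (insert-rowsSorted T s) ⟩
  readingWord (insert x T) ++ w    ≈⟨ ≈-congʳ w (readingWord-insert T s) ⟩
  (readingWord T ++ x ∷ []) ++ w   ≡⟨ List.++-assoc (readingWord T) (x ∷ []) w ⟩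
  readingWord T ++ x ∷ w           ∎
  where open ≈-Reasoning

_≼_ : Row → Row → Set
_ ≼ [] = ⊤
[] ≼ (_ ∷ _) = ⊥
(p ∷ a) ≼ (q ∷ b) = p ≤ q × a ≼ b

≼-refl : ∀ r → r ≼ r
≼-refl [] = tt
≼-refl (h ∷ t) = ℤ.≤-refl , ≼-refl t

insertRow-≼ : ∀ x r → proj₂ (insertRow x r) ≼ r
insertRow-≼ x [] = tt
insertRow-≼ x (h ∷ t) with <⊎≥ x h
... | inj₁ x<h rewrite insertRow-bumps t x<h = ℤ.<⇒≤ x<h , ≼-refl t
... | inj₂ h≤x rewrite insertRow-passes t h≤x = ℤ.≤-refl , insertRow-≼ x t

colStrict-≼ : ∀ a b s → a ≼ b → ColStrict b s → ColStrict a s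
colStrict-≼ a b [] _ _ = tt
colStrict-≼ (p ∷ a) (q ∷ b) (l ∷ s) (p≤q , a≼b) (q<l , cs) = ℤ.≤-<-trans p≤q q<l , colStrict-≼ a b s a≼b cs

ColStrictAfterBump : Maybe ℤ → Row → Row → Set
ColStrictAfterBump nothing r s = ColStrict r s
ColStrictAfterBump (just y) r s = ColStrict r (proj₂ (insertRow y s))

insertRow-colStrict : ∀ x r s → ColStrict r s →
  ColStrictAfterBump (proj₁ (insertRow x r)) (proj₂ (insertRow x r)) s
insertRow-colStrict x [] [] _ = tt
insertRow-colStrict x (h ∷ t) s cs with <⊎≥ x h
insertRow-colStrict x (h ∷ t) [] cs | inj₁ x<h rewrite insertRow-bumps t x<h = x<h , tt
insertRow-colStrict x (h ∷ t) (g ∷ s) (h<g , cs) | inj₁ x<h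
  rewrite insertRow-bumps t x<h | insertRow-bumps s h<g = x<h , cs
insertRow-colStrict x (h ∷ t) [] cs | inj₂ h≤x rewrite insertRow-passes t h≤x
  with proj₁ (insertRow x t) | bumped-> {x} t
... | nothing | _ = tt
... | just y | just x<y = ℤ.≤-<-trans h≤x x<y , tt
insertRow-colStrict x (h ∷ t) (g ∷ s) (h<g , cs) | inj₂ h≤x rewrite insertRow-passes t h≤x
  with proj₁ (insertRow x t) | insertRow-colStrict x t s cs | bumped-> {x} t
... | nothing | cs′ | _ = h<g , cs′
... | just y | cs′ | just x<y with <⊎≥ y g
...   | inj₁ y<g rewrite insertRow-bumps s y<g = ℤ.≤-<-trans h≤x x<y , colStrict-≼ _ t s (insertRow-≼ x t) cs
...   | inj₂ g≤y rewrite insertRow-passes s g≤y = h<g , cs′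

insertRow-nonempty : ∀ x r → ¬ proj₂ (insertRow x r) ≡ []
insertRow-nonempty x [] ()
insertRow-nonempty x (h ∷ t) with <⊎≥ x h
... | inj₁ x<h rewrite insertRow-bumps t x<h = λ ()
... | inj₂ h≤x rewrite insertRow-passes t h≤x = λ ()

firstRow : Tab → Row
firstRow [] = []
firstRow (r ∷ _) = r

firstRow-insert : ∀ y T → firstRow (insert y T) ≡ proj₂ (insertRow y (firstRow T))
firstRow-insert y [] = refl
firstRow-insert y (r ∷ T) rewrite insert-∷ y r T = refl

IsTableauWithTop : Row → Tab → Set
IsTableauWithTop r T = ¬ r ≡ [] × Sorted r × ColStrict r (firstRow T) × IsTableau T

isTableau-∷⁻ : ∀ r T → IsTableau (r ∷ T) → IsTableauWithTop r T
isTableau-∷⁻ r [] (r≢[] , s) = r≢[] , s , tt , tt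
isTableau-∷⁻ r (_ ∷ _) t = t

isTableau-∷⁺ : ∀ r T → IsTableauWithTop r T → IsTableau (r ∷ T)
isTableau-∷⁺ r [] (r≢[] , s , _ , _) = r≢[] , s
isTableau-∷⁺ r (_ ∷ _) t = t

insert-isTableau : ∀ {x} T → IsTableau T → IsTableau (insert x T)
insert-isTableau [] _ = (λ ()) , [-]
insert-isTableau {x} (r ∷ T) isTab with isTableau-∷⁻ r T isTab
... | _ , s , cs , isTabT rewrite insert-∷ x r T
  with proj₁ (insertRow x r) | insertRow-colStrict x r (firstRow T) cs
...   | nothing | cs′ = isTableau-∷⁺ _ T (insertRow-nonempty x r , insertRow-sorted r s , cs′ , isTabT)
...   | just y | cs′ = isTableau-∷⁺ _ (insert y T)
  (insertRow-nonempty x r , insertRow-sorted r s ,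
   subst (ColStrict _) (sym (firstRow-insert y T)) cs′ , insert-isTableau T isTabT)

◁-isTableau : ∀ T w → IsTableau T → IsTableau (T ◁ w)
◁-isTableau T [] isTab = isTab
◁-isTableau T (x ∷ w) isTab = ◁-isTableau (insert x T) w (insert-isTableau T isTab)

isTableau⇒rowsSorted : ∀ T → IsTableau T → RowsSorted T
isTableau⇒rowsSorted [] _ = []
isTableau⇒rowsSorted (r ∷ []) (_ , s) = s ∷ []
isTableau⇒rowsSorted (r ∷ r′ ∷ T) (_ , s , _ , isTab) = s ∷ isTableau⇒rowsSorted (r′ ∷ T) isTab

-- outflow is the word bumped out of row a while inserting w.
record Cut (a : ℕ) (T : Tab) (w : List ℤ) : Set where
  field
    outflow      : List ℤ
    top-◁        : take a (T ◁ w) ≡ take a (take a T ◁ w)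
    lower-◁      : drop a (T ◁ w) ≡ drop a T ◁ outflow
    top-overflow : drop a (take a T ◁ w) ≡ [] ◁ outflow

◁-cut : ∀ a T w → Cut a T w
◁-cut-∷ : ∀ a r T w → Cut (suc a) (r ∷ T) w

◁-cut zero T w = record { outflow = w ; top-◁ = refl ; lower-◁ = refl ; top-overflow = refl }
◁-cut (suc a) (r ∷ T) w = ◁-cut-∷ a r T w
◁-cut (suc a) [] [] = record { outflow = [] ; top-◁ = refl ; lower-◁ = refl ; top-overflow = refl }
◁-cut (suc a) [] (x ∷ w) = record { outflow = outflow ; top-◁ = refl ; lower-◁ = lower ; top-overflow = lower }
  where
  open Cut (◁-cut-∷ a [] [] (x ∷ w))
  lower : drop (suc a) ([] ◁ (x ∷ w)) ≡ [] ◁ outflow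
  lower = trans lower-◁ (cong (_◁ outflow) (List.drop-[] a))
◁-cut-∷ a r T w = record
  { outflow = outflow
  ; top-◁ = begin
      take (suc a) ((r ∷ T) ◁ w)        ≡⟨ cong (take (suc a)) (◁-∷ r T w) ⟩
      r′ ∷ take a (T ◁ w′)              ≡⟨ cong (r′ ∷_) top-◁ ⟩
      r′ ∷ take a (take a T ◁ w′)       ≡⟨ cong (take (suc a)) (◁-∷ r (take a T) w) ⟨
      take (suc a) ((r ∷ take a T) ◁ w) ∎
  ; lower-◁ = trans (cong (drop (suc a)) (◁-∷ r T w)) lower-◁
  ; top-overflow = trans (cong (drop (suc a)) (◁-∷ r (take a T) w)) top-overflow
  }
  where
  open ≡-Reasoning
  r′ = proj₁ (insertRowWord r w)
  w′ = proj₂ (insertRowWord r w)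
  open Cut (◁-cut a T w′)

readingWord-cut : ∀ a T w → RowsSorted T →
  readingWord (take a T) ++ w ≈ Cut.outflow (◁-cut a T w) ++ readingWord (take a (T ◁ w))
readingWord-cut a T w s = begin
  readingWord T₀ ++ w                                             ≈⟨ readingWord-◁ T₀ w (All.take⁺ a s) ⟨
  readingWord (T₀ ◁ w)                                            ≡⟨ cong readingWord (List.take++drop≡id a (T₀ ◁ w)) ⟨
  readingWord (take a (T₀ ◁ w) ++ drop a (T₀ ◁ w))                ≡⟨ readingWord-++ (take a (T₀ ◁ w)) (drop a (T₀ ◁ w)) ⟩
  readingWord (drop a (T₀ ◁ w)) ++ readingWord (take a (T₀ ◁ w))  ≡⟨ cong₂ (λ l t → readingWord l ++ readingWord t) top-overflow (sym top-◁) ⟩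
  readingWord ([] ◁ outflow) ++ readingWord (take a (T ◁ w))      ≈⟨ ≈-congʳ _ (readingWord-◁ [] outflow []) ⟩
  outflow ++ readingWord (take a (T ◁ w))                         ∎
  where
  open ≈-Reasoning
  open Cut (◁-cut a T w)
  T₀ = take a T

lemma5 : (a : ℕ) (Y S M N : Tab) →
    IsTableau Y → IsTableau S → IsTableau M → IsTableau N →
    cutLower a Y ≡ M · N →
    Σ Tab (λ Ã′ → IsTableau Ã′ ×
      (N · cutTop a Y) · S ≡ Ã′ · cutTop a (Y · S) ×
      M · Ã′ ≡ cutLower a (Y · S))
-- Only the reading word of S matters, so S need not be a tableau.
lemma5 a Y S M N isTabY _ isTabM isTabN Ỹ≡M·N =
  N ◁ outflow , ◁-isTableau N outflow isTabN , top-identity , lower-identity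
  where
  open ≡-Reasoning
  s = readingWord S
  open Cut (◁-cut a Y s)
  sortedN = isTableau⇒rowsSorted N isTabN

  top-identity : N ◁ readingWord (take a Y) ◁ s ≡ N ◁ outflow ◁ readingWord (take a (Y ◁ s))
  top-identity = begin
    N ◁ readingWord (take a Y) ◁ s             ≡⟨ ◁-++ N (readingWord (take a Y)) s ⟨
    N ◁ (readingWord (take a Y) ++ s)          ≡⟨ same-insertion (readingWord-cut a Y s (isTableau⇒rowsSorted Y isTabY)) N sortedN ⟩
    N ◁ (outflow ++ readingWord (take a (Y ◁ s))) ≡⟨ ◁-++ N outflow _ ⟩
    N ◁ outflow ◁ readingWord (take a (Y ◁ s)) ∎

  lower-identity : M ◁ readingWord (N ◁ outflow) ≡ drop a (Y ◁ s)
  lower-identity = begin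
    M ◁ readingWord (N ◁ outflow)  ≡⟨ same-insertion (readingWord-◁ N outflow sortedN) M (isTableau⇒rowsSorted M isTabM) ⟩
    M ◁ (readingWord N ++ outflow) ≡⟨ ◁-++ M (readingWord N) outflow ⟩
    M · N ◁ outflow                ≡⟨ cong (_◁ outflow) Ỹ≡M·N ⟨
    drop a Y ◁ outflow             ≡⟨ lower-◁ ⟨
    drop a (Y ◁ s)                 ∎
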